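{- $\mathrm{dc}_+(3) \geq 7$ and $\mathrm{dc}(4) \geq 12$. That is: in a free semigroup $A^+$ there exists a decreasing chain of $7$ equations over $3$ unknowns, and in a free monoid $A^*$ there exists a decreasing chain of $12$ equations over $4$ unknowns.
   Context: $A$ is an alphabet with at least two letters. For a set $\Xi$ of $n$ variables, an equation in the free semigroup $A^+$ is a pair $U=V$ with $U,V\in\Xi^+$, and a solution is a morphism $h:\Xi^+\to A^+$ with $h(U)=h(V)$; in the free monoid $A^*$ equations are pairs $U=V$ with $U,V\in\Xi^*$ and solutions are morphisms $h:\Xi^*\to A^*$ with $h(U)=h(V)$. A morphism solves a system if it solves each equation (every morphism solves the empty system); systems are equivalent if they have the same solutions. A finite sequence $E_1,\dots,E_m$ of equations is a decreasing chain if for every $i\in\{0,\dots,m-1\}$ the system $E_1,\dots,E_i$ is not equivalent to $E_1,\dots,E_{i+1}$. $\mathrm{dc}(n)$ (resp. $\mathrm{dc}_+(n)$) is the maximal length of a decreasing chain over $n$ unknowns in the free monoid (resp. free semigroup). -}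

module Defs where

open import Data.Nat using (ℕ; suc; _<_)
open import Data.Fin using (Fin)
open import Data.List as List using (List; take; length)
open import Data.List.NonEmpty as List⁺ using (List⁺)
open import Data.List.Relation.Unary.All using (All)
open import Data.Product using (_×_; _,_; Σ-syntax)
open import Function.Bundles using (_⇔_)
open import Relation.Binary.PropositionalEquality using (_≡_)
open import Relation.Nullary using (¬_)

HasTwoLetters : Set → Set
HasTwoLetters A = Σ[ a ∈ A ] Σ[ b ∈ A ] ¬ (a ≡ b)

-- The set Ξ of n unknowns is Fin n.

-- Free monoid A*: words are lists; an equation is a pair (U , V) with
-- U , V ∈ Ξ*; a morphism h : Ξ* → A* is determined by (and given by)
-- its values on the generators, and acts on words by concatenation.

MonoidEquation : ℕ → Set
MonoidEquation n = List (Fin n) × List (Fin n)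

MonoidMorphism : ℕ → Set → Set
MonoidMorphism n A = Fin n → List A

applyM : ∀ {n A} → MonoidMorphism n A → List (Fin n) → List A
applyM h = List.concatMap h

SolvesM : ∀ {n A} → MonoidMorphism n A → MonoidEquation n → Set
SolvesM h (U , V) = applyM h U ≡ applyM h V

SolvesSysM : ∀ {n A} → MonoidMorphism n A → List (MonoidEquation n) → Set
SolvesSysM h S = All (SolvesM h) S

EquivalentM : ∀ {n} → Set → (S T : List (MonoidEquation n)) → Set
EquivalentM {n} A S T = (h : MonoidMorphism n A) → SolvesSysM h S ⇔ SolvesSysM h T

DecreasingChainM : ∀ {n} → Set → List (MonoidEquation n) → Set
DecreasingChainM A E =
  (i : ℕ) → i < length E → ¬ EquivalentM A (take i E) (take (suc i) E)

-- Free semigroup A⁺: words are nonempty lists; morphisms Ξ⁺ → A⁺ send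
-- each unknown to a nonempty word.

SemigroupEquation : ℕ → Set
SemigroupEquation n = List⁺ (Fin n) × List⁺ (Fin n)

SemigroupMorphism : ℕ → Set → Set
SemigroupMorphism n A = Fin n → List⁺ A

applyS : ∀ {n A} → SemigroupMorphism n A → List⁺ (Fin n) → List⁺ A
applyS h = List⁺.concatMap h

SolvesS : ∀ {n A} → SemigroupMorphism n A → SemigroupEquation n → Set
SolvesS h (U , V) = applyS h U ≡ applyS h V

SolvesSysS : ∀ {n A} → SemigroupMorphism n A → List (SemigroupEquation n) → Set
SolvesSysS h S = All (SolvesS h) S

EquivalentS : ∀ {n} → Set → (S T : List (SemigroupEquation n)) → Set
EquivalentS {n} A S T = (h : SemigroupMorphism n A) → SolvesSysS h S ⇔ SolvesSysS h T

DecreasingChainS : ∀ {n} → Set → List (SemigroupEquation n) → Set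
DecreasingChainS A E =
  (i : ℕ) → i < length E → ¬ EquivalentS A (take i E) (take (suc i) E)

module Submission where

-- A list E₁,…,Eₘ is a decreasing chain as soon as every step i is
-- *separated*: some morphism h solves E₁,…,Eᵢ but not E₁,…,Eᵢ₊₁ (such an
-- h refutes the equivalence of the two systems).  The separating morphisms
-- are written over the alphabet Bool and transported to A along an
-- injective letter map ι : Bool → A, which changes no solution since
-- renaming letters injectively is injective on words.  Over Bool solvability
-- is decidable, so "each step is separated by its listed witness" is
-- checked by evaluation.

open import Defs
open import Data.Empty using (⊥-elim)
open import Data.Bool using (Bool; true; false)
import Data.Bool.Properties as Bool
open import Data.Fin using (Fin; zero; suc; toℕ; fromℕ<)
open import Data.Fin.Properties using (toℕ-fromℕ<)
import Data.Fin.Properties as Fin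
open import Data.List as List using (List; []; _∷_; _++_; length; take)
open import Data.List.NonEmpty as List⁺ using (List⁺; _∷_; toList)
open import Data.List.NonEmpty.Properties using (toList-⁺++)
open import Data.List.Properties using (map-∘; concat-map; map-injective; ≡-dec)
open import Data.List.Relation.Unary.All as All using (All)
open import Data.Nat using (ℕ; suc; _<_)
open import Data.Product using (_×_; _,_; proj₁; proj₂; Σ-syntax)
open import Data.Vec as Vec using (Vec; _∷_; [])
open import Function using (_∘_; Injective)
open import Function.Bundles using (_⇔_; mk⇔; Equivalence)
import Function.Properties.Equivalence as ⇔
open import Relation.Binary.Definitions using (DecidableEquality)
open import Relation.Binary.PropositionalEquality
  using (_≡_; refl; sym; trans; cong; subst; module ≡-Reasoning)
open import Relation.Nullary using (¬_; Dec)
open import Relation.Nullary.Decidable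
  using (True; toWitness; _×-dec_; ¬?)
import Relation.Nullary.Decidable as Dec

-- (1) Separated steps make a decreasing chain.  `Solves h e` is any
-- notion of "the morphism h solves the equation e"; DecreasingChainM and
-- DecreasingChainS are both `Decreasing` for the appropriate `Solves`.

module Separation {Eqn Mor : Set} (Solves : Mor → Eqn → Set) where

  SolvesSys : Mor → List Eqn → Set
  SolvesSys h = All (Solves h)

  Decreasing : List Eqn → Set
  Decreasing Es = (i : ℕ) → i < length Es →
    ¬ ((h : Mor) → SolvesSys h (take i Es) ⇔ SolvesSys h (take (suc i) Es))

  Separates : Mor → List Eqn → ℕ → Set
  Separates h Es i = SolvesSys h (take i Es) × ¬ SolvesSys h (take (suc i) Es)

  separated⇒decreasing : (Es : List Eqn) (w : Fin (length Es) → Mor) →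
    ((k : Fin (length Es)) → Separates (w k) Es (toℕ k)) → Decreasing Es
  separated⇒decreasing Es w separated i i<m equivalent =
    fails (Equivalence.to (equivalent (w k)) solves)
    where
    k : Fin (length Es)
    k = fromℕ< i<m
    step-i : Separates (w k) Es i
    step-i = subst (Separates (w k) Es) (toℕ-fromℕ< i<m) (separated k)
    solves = proj₁ step-i
    fails = proj₂ step-i

-- If morphisms of kind Mor₀ embed
-- into Mor without changing which equations they solve, and solving is
-- decidable for Mor₀, then a list of Mor₀-witnesses certifies a
-- decreasing chain by a decision procedure, i.e. by evaluation.

module Witnesses {Eqn Mor Mor₀ : Set}
  (Solves : Mor → Eqn → Set) (Solves₀ : Mor₀ → Eqn → Set)
  (embed : Mor₀ → Mor)
  (embed-solves : ∀ g e → Solves (embed g) e ⇔ Solves₀ g e)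
  (solves₀? : ∀ g e → Dec (Solves₀ g e)) where

  open Separation using (Separates; Decreasing; separated⇒decreasing)

  embed-separates : ∀ {g Es i} → Separates Solves₀ g Es i → Separates Solves (embed g) Es i
  embed-separates {g} (solves , fails) =
    All.map (Equivalence.from (embed-solves g _)) solves ,
    fails ∘ All.map (Equivalence.to (embed-solves g _))

  separates₀? : ∀ g Es i → Dec (Separates Solves₀ g Es i)
  separates₀? g Es i =
    All.all? (solves₀? g) (take i Es) ×-dec ¬? (All.all? (solves₀? g) (take (suc i) Es))

  AllStepsSeparated : (Es : List Eqn) → Vec Mor₀ (length Es) → Set
  AllStepsSeparated Es ws =
    True (Fin.all? λ k → separates₀? (Vec.lookup ws k) Es (toℕ k))

  decreasing-by-witnesses : (Es : List Eqn) (ws : Vec Mor₀ (length Es)) →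
    AllStepsSeparated Es ws → Decreasing Solves Es
  decreasing-by-witnesses Es ws checked =
    separated⇒decreasing Solves Es (embed ∘ Vec.lookup ws)
      (λ k → embed-separates (toWitness checked k))

module LetterEmbedding {B A : Set} (_≟_ : DecidableEquality B)
  (ι : B → A) (ι-injective : Injective _≡_ _≡_ ι) where

  embedM : ∀ {n} → MonoidMorphism n B → MonoidMorphism n A
  embedM g = List.map ι ∘ g

  applyM-embed : ∀ {n} (g : MonoidMorphism n B) w →
    applyM (embedM g) w ≡ List.map ι (applyM g w)
  applyM-embed g w = trans (cong List.concat (map-∘ w)) (concat-map (List.map g w))

  embedM-solves : ∀ {n} (g : MonoidMorphism n B) (e : MonoidEquation n) →
    SolvesM (embedM g) e ⇔ SolvesM g e
  embedM-solves g (U , V) = mk⇔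
    (λ p → map-injective ι-injective
      (trans (sym (applyM-embed g U)) (trans p (applyM-embed g V))))
    (λ p → trans (applyM-embed g U) (trans (cong (List.map ι) p) (sym (applyM-embed g V))))

  solvesM? : ∀ {n} (g : MonoidMorphism n B) e → Dec (SolvesM g e)
  solvesM? g (U , V) = ≡-dec _≟_ (applyM g U) (applyM g V)

  -- A semigroup morphism acts on underlying lists as the monoid morphism
  -- `toList ∘ h`; since toList is injective, solutions correspond.
  toList-applyS : ∀ {n C} (h : SemigroupMorphism n C) w →
    toList (applyS h w) ≡ applyM (toList ∘ h) (toList w)
  toList-applyS h (x ∷ xs) = begin
    toList (h x List⁺.⁺++ List.concat (List.map toList (List.map h xs)))
      ≡⟨ sym (toList-⁺++ (h x) _) ⟩
    toList (h x) ++ List.concat (List.map toList (List.map h xs))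
      ≡⟨ cong (λ ws → toList (h x) ++ List.concat ws) (sym (map-∘ xs)) ⟩
    toList (h x) ++ List.concat (List.map (toList ∘ h) xs) ∎
    where open ≡-Reasoning

  toList-injective : ∀ {C : Set} {u v : List⁺ C} → toList u ≡ toList v → u ≡ v
  toList-injective {u = x ∷ xs} refl = refl

  forget : ∀ {n} → SemigroupEquation n → MonoidEquation n
  forget (U , V) = toList U , toList V

  solvesS⇔solvesM : ∀ {n C} (h : SemigroupMorphism n C) e →
    SolvesS h e ⇔ SolvesM (toList ∘ h) (forget e)
  solvesS⇔solvesM h (U , V) = mk⇔
    (λ p → trans (sym (toList-applyS h U)) (trans (cong toList p) (toList-applyS h V)))
    (λ p → toList-injective
      (trans (toList-applyS h U) (trans p (sym (toList-applyS h V)))))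

  embedS : ∀ {n} → SemigroupMorphism n B → SemigroupMorphism n A
  embedS g = List⁺.map ι ∘ g

  embedS-solves : ∀ {n} (g : SemigroupMorphism n B) (e : SemigroupEquation n) →
    SolvesS (embedS g) e ⇔ SolvesS g e
  embedS-solves g e = ⇔.trans (solvesS⇔solvesM (embedS g) e)
    (⇔.trans (embedM-solves (toList ∘ g) (forget e)) (⇔.sym (solvesS⇔solvesM g e)))

  solvesS? : ∀ {n} (g : SemigroupMorphism n B) e → Dec (SolvesS g e)
  solvesS? g e = Dec.map (⇔.sym (solvesS⇔solvesM g e)) (solvesM? (toList ∘ g) (forget e))

a b : Bool
a = true
b = false

module SemigroupChain where

  x y z : Fin 3
  x = zero
  y = suc zero
  z = suc (suc zero)

  chain : List (SemigroupEquation 3)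
  chain =
    (x ∷ x ∷ z ∷ y ∷ [] , y ∷ x ∷ z ∷ x ∷ []) ∷
    (x ∷ x ∷ z ∷ x ∷ y ∷ z ∷ y ∷ [] , y ∷ y ∷ z ∷ x ∷ x ∷ z ∷ x ∷ []) ∷
    (x ∷ y ∷ [] , y ∷ x ∷ []) ∷
    (x ∷ [] , y ∷ []) ∷
    (x ∷ x ∷ z ∷ y ∷ [] , y ∷ z ∷ x ∷ x ∷ []) ∷
    (x ∷ [] , z ∷ []) ∷
    (y ∷ [] , x ∷ x ∷ []) ∷
    []

  ⟨_∣_∣_⟩ : List⁺ Bool → List⁺ Bool → List⁺ Bool → SemigroupMorphism 3 Bool
  ⟨ u ∣ v ∣ w ⟩ = Vec.lookup (u ∷ v ∷ w ∷ [])

  witnesses : Vec (SemigroupMorphism 3 Bool) 7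
  witnesses =
    ⟨ a ∷ [] ∣ b ∷ [] ∣ a ∷ [] ⟩ ∷
    ⟨ a ∷ [] ∣ a ∷ a ∷ b ∷ a ∷ [] ∣ b ∷ a ∷ a ∷ b ∷ [] ⟩ ∷
    ⟨ a ∷ [] ∣ a ∷ a ∷ b ∷ a ∷ [] ∣ b ∷ [] ⟩ ∷
    ⟨ a ∷ [] ∣ a ∷ a ∷ [] ∣ a ∷ [] ⟩ ∷
    ⟨ a ∷ [] ∣ a ∷ [] ∣ b ∷ [] ⟩ ∷
    ⟨ a ∷ [] ∣ a ∷ [] ∣ a ∷ a ∷ [] ⟩ ∷
    ⟨ a ∷ [] ∣ a ∷ [] ∣ a ∷ [] ⟩ ∷
    []

module MonoidChain where

  x y z u : Fin 4
  x = zero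
  y = suc zero
  z = suc (suc zero)
  u = suc (suc (suc zero))

  chain : List (MonoidEquation 4)
  chain =
    (x ∷ y ∷ [] , y ∷ x ∷ []) ∷
    (x ∷ z ∷ u ∷ [] , z ∷ u ∷ x ∷ []) ∷
    (x ∷ z ∷ y ∷ u ∷ [] , z ∷ y ∷ u ∷ x ∷ []) ∷
    (x ∷ z ∷ [] , z ∷ x ∷ []) ∷
    (x ∷ [] , []) ∷
    (y ∷ z ∷ u ∷ [] , z ∷ u ∷ y ∷ []) ∷
    (y ∷ z ∷ y ∷ u ∷ z ∷ u ∷ [] , z ∷ u ∷ z ∷ y ∷ u ∷ y ∷ []) ∷
    (y ∷ z ∷ [] , z ∷ y ∷ []) ∷
    ([] , y ∷ []) ∷
    (z ∷ u ∷ [] , u ∷ z ∷ []) ∷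
    ([] , z ∷ []) ∷
    ([] , u ∷ []) ∷
    []

  ⟨_∣_∣_∣_⟩ : List Bool → List Bool → List Bool → List Bool → MonoidMorphism 4 Bool
  ⟨ p ∣ q ∣ r ∣ s ⟩ = Vec.lookup (p ∷ q ∷ r ∷ s ∷ [])

  witnesses : Vec (MonoidMorphism 4 Bool) 12
  witnesses =
    ⟨ a ∷ []     ∣ b ∷ []     ∣ []     ∣ []             ⟩ ∷
    ⟨ a ∷ []     ∣ []         ∣ []     ∣ b ∷ []         ⟩ ∷
    ⟨ a ∷ b ∷ [] ∣ a ∷ b ∷ [] ∣ a ∷ [] ∣ b ∷ []         ⟩ ∷
    ⟨ a ∷ b ∷ [] ∣ []         ∣ a ∷ [] ∣ b ∷ []         ⟩ ∷
    ⟨ a ∷ []     ∣ []         ∣ []     ∣ []             ⟩ ∷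
    ⟨ []         ∣ a ∷ []     ∣ []     ∣ b ∷ []         ⟩ ∷
    ⟨ []         ∣ a ∷ b ∷ [] ∣ a ∷ [] ∣ b ∷ a ∷ b ∷ [] ⟩ ∷
    ⟨ []         ∣ a ∷ b ∷ [] ∣ a ∷ [] ∣ b ∷ []         ⟩ ∷
    ⟨ []         ∣ a ∷ []     ∣ []     ∣ []             ⟩ ∷
    ⟨ []         ∣ []         ∣ a ∷ [] ∣ b ∷ []         ⟩ ∷
    ⟨ []         ∣ []         ∣ a ∷ [] ∣ []             ⟩ ∷
    ⟨ []         ∣ []         ∣ []     ∣ a ∷ []         ⟩ ∷
    []

theorem4 : (A : Set) → HasTwoLetters A →
    (Σ[ E ∈ List (SemigroupEquation 3) ] (length E ≡ 7 × DecreasingChainS A E))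
    × (Σ[ E ∈ List (MonoidEquation 4) ] (length E ≡ 12 × DecreasingChainM A E))
theorem4 A (a′ , b′ , a′≢b′) =
  (SemigroupChain.chain , refl , S.decreasing-by-witnesses _ SemigroupChain.witnesses _) ,
  (MonoidChain.chain , refl , M.decreasing-by-witnesses _ MonoidChain.witnesses _)
  where
  ι : Bool → A
  ι true = a′
  ι false = b′

  ι-injective : Injective _≡_ _≡_ ι
  ι-injective {true} {true} _ = refl
  ι-injective {true} {false} p = ⊥-elim (a′≢b′ p)
  ι-injective {false} {true} p = ⊥-elim (a′≢b′ (sym p))
  ι-injective {false} {false} _ = refl

  open LetterEmbedding Bool._≟_ ι ι-injective
  module S = Witnesses SolvesS SolvesS embedS embedS-solves solvesS?
  module M = Witnesses SolvesM SolvesM embedM embedM-solves solvesM?
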